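{- Let $w\in S_n$. If $w$ is 321-avoiding, then no rc-graph in $\mathcal R(w)$ has a line which traverses one cross vertically and another cross horizontally. Conversely, if $w$ contains the pattern 321, then every rc-graph in $\mathcal R(w)$ has such a line.
   Context: An rc-graph for $w\in S_n$ is a set $R\subseteq\{(i,j)\in\mathbb{Z}_{>0}^2:i+j\le n\}$ such that, listing its elements $(i_1,j_1),(i_2,j_2),\ldots$ by increasing $i$ and, for equal $i$, decreasing $j$, the word $a_1a_2\ldots$ with $a_k=i_k+j_k-1$ is a reduced word for $w$; $\mathcal R(w)$ is the set of these. Its line diagram: $n$ lines going up and to the right (matrix coordinates, row 1 on top), the $i$th line entering position $(i,1)$ from the left and ending at the top of position $(1,w_i)$; at a position $(i,j)$ where two lines meet, they cross if $(i,j)\in R$ (one line passing horizontally from left to right, the other vertically from bottom to top) and otherwise avoid each other. A line traverses a cross horizontally (resp. vertically) if it passes through it from left to right (resp. from bottom to top). $w$ is 321-avoiding if there are no $i<j<k$ with $w_i>w_j>w_k$. -}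

module Defs where

open import Data.Nat using (ℕ; zero; suc; _+_; _∸_; _≤_; _<_; _≡ᵇ_)
open import Data.Bool using (Bool; true; false; if_then_else_)
open import Data.Fin using (Fin; toℕ)
import Data.Fin as F
open import Data.Fin.Permutation using (Permutation′; _⟨$⟩ʳ_)
open import Data.List using (List; []; _∷_; length; upTo; downFrom; map; concatMap)
open import Data.List.Relation.Unary.All using (All)
open import Data.Product using (Σ; _×_; _,_; ∃)
open import Relation.Binary.PropositionalEquality using (_≡_; _≢_)
open import Relation.Nullary using (¬_)

-- Permutations w ∈ S_n are elements of Permutation′ n (bijections of Fin n).
-- We use 1-based values: the value w_i (i ∈ {1..n}) is suc (toℕ (w ⟨$⟩ʳ x))
-- for x = i-1 : Fin n.

Contains321 : {n : ℕ} → Permutation′ n → Set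
Contains321 {n} w =
  Σ (Fin n) λ i → Σ (Fin n) λ j → Σ (Fin n) λ k →
    (i F.< j) × (j F.< k) × (w ⟨$⟩ʳ k F.< w ⟨$⟩ʳ j) × (w ⟨$⟩ʳ j F.< w ⟨$⟩ʳ i)

Avoids321 : {n : ℕ} → Permutation′ n → Set
Avoids321 w = ¬ Contains321 w

sTrans : ℕ → ℕ → ℕ
sTrans a x = if x ≡ᵇ a then suc a else (if x ≡ᵇ suc a then a else x)

prodWord : List ℕ → ℕ → ℕ
prodWord []       x = x
prodWord (a ∷ as) x = sTrans a (prodWord as x)

Letter : ℕ → ℕ → Set
Letter n a = (1 ≤ a) × (a < n)

IsWordFor : (n : ℕ) → Permutation′ n → List ℕ → Set
IsWordFor n w as =
  All (Letter n) as ×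
  (∀ (x : Fin n) → prodWord as (suc (toℕ x)) ≡ suc (toℕ (w ⟨$⟩ʳ x)))

IsReducedWord : (n : ℕ) → Permutation′ n → List ℕ → Set
IsReducedWord n w as =
  IsWordFor n w as × (∀ bs → IsWordFor n w bs → length as ≤ length bs)

PosSet : Set
PosSet = ℕ → ℕ → Bool

InStaircase : ℕ → PosSet → Set
InStaircase n R = ∀ i j → R i j ≡ true → (1 ≤ i) × (1 ≤ j) × (i + j ≤ n)

rowsUp : ℕ → List ℕ
rowsUp n = map suc (upTo n)

colsDown : ℕ → List ℕ
colsDown n = map suc (downFrom n)

readingWord : ℕ → PosSet → List ℕ
readingWord n R =
  concatMap (λ i → concatMap (λ j → if R i j then (i + j ∸ 1) ∷ [] else [])
                             (colsDown n))
            (rowsUp n)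

IsRCGraph : (n : ℕ) → Permutation′ n → PosSet → Set
IsRCGraph n w R = InStaircase n R × IsReducedWord n w (readingWord n R)

-- Line diagram (matrix coordinates, row 1 on top).  At a cross (position in R)
-- it goes straight; elsewhere the lines avoid each other (elbow):
-- from the left it turns up, from the bottom it turns right.

data InDir : Set where
  fromLeft fromBottom : InDir

data OutDir : Set where
  toRight toTop : OutDir

exitDir : Bool → InDir → OutDir
exitDir true  fromLeft   = toRight
exitDir true  fromBottom = toTop
exitDir false fromLeft   = toTop
exitDir false fromBottom = toRight

-- Enters R k i j d : the line number k (= toℕ k + 1) passes through
-- position (i,j), entering it from direction d.
data Enters {n : ℕ} (R : PosSet) (k : Fin n) : ℕ → ℕ → InDir → Set where
  start   : Enters R k (suc (toℕ k)) 1 fromLeft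
  goRight : ∀ {i j d} → Enters R k i j d → exitDir (R i j) d ≡ toRight →
            Enters R k i (suc j) fromLeft
  goUp    : ∀ {i j d} → Enters R k (suc (suc i)) j d →
            exitDir (R (suc (suc i)) j) d ≡ toTop →
            Enters R k (suc i) j fromBottom

TraversesHorizontally : {n : ℕ} → PosSet → Fin n → ℕ → ℕ → Set
TraversesHorizontally R k i j = (R i j ≡ true) × Enters R k i j fromLeft

TraversesVertically : {n : ℕ} → PosSet → Fin n → ℕ → ℕ → Set
TraversesVertically R k i j = (R i j ≡ true) × Enters R k i j fromBottom

HasMixedLine : (n : ℕ) → PosSet → Set
HasMixedLine n R =
  Σ (Fin n) λ k → Σ ℕ λ i → Σ ℕ λ j → Σ ℕ λ i' → Σ ℕ λ j' →
    ((i , j) ≢ (i' , j')) ×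
    TraversesVertically R k i j × TraversesHorizontally R k i' j'

{-# OPTIONS --safe #-}
-- Read the reading word from right to left.  After the letters of the cells following (i, j)
-- have been applied, the product sends line k to the antidiagonal slot at which line k crosses
-- a staircase-shaped frontier through the diagram; so the cross (i, j), with letter
-- a = i + j - 1, is exactly where the lines in slots a and a + 1 meet, the one in slot a
-- entering it from the left and the one in slot a + 1 from below.  In a reduced word the letter
-- that swaps two values does so exactly once and turns them into an inversion, so the line
-- traversing a cross vertically is the larger index of an inversion of w and the one traversing
-- it horizontally the smaller.  A line doing both is the middle of a 321 pattern; conversely,
-- the middle of a 321 pattern meets its two partners at two crosses, one passed vertically and
-- one horizontally.
module Submission where

open import Defs
open import Data.Bool using (true; false; T; if_then_else_)
open import Data.Bool.Properties using (T-≡)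
open import Data.Empty using (⊥; ⊥-elim)
open import Data.Fin using (Fin; toℕ; fromℕ<)
import Data.Fin as F
open import Data.Fin.Permutation using (Permutation′; _⟨$⟩ʳ_)
open import Data.Fin.Properties using (toℕ-fromℕ<; toℕ<n)
open import Data.List using (List; []; _∷_; _++_; length; concatMap; map; applyUpTo)
open import Data.List.Properties using (++-assoc; length-++)
open import Data.List.Relation.Unary.All using (All; []; _∷_)
open import Data.List.Relation.Unary.All.Properties using (++⁺; ++⁻ˡ; ++⁻ʳ)
open import Data.Nat using (ℕ; zero; suc; _+_; _∸_; _≤_; _<_; _≡ᵇ_; z≤n; s≤s; _<?_)
open import Data.Nat.Properties
open import Data.Product using (∃-syntax; _×_; _,_; proj₁; proj₂)
open import Data.Sum using (_⊎_; inj₁; inj₂)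
open import Function.Base using (id; _∘_)
open import Function.Bundles using (Equivalence; _⇔_; mk⇔)
open import Relation.Binary.Definitions using (tri<; tri≈; tri>)
open import Relation.Binary.PropositionalEquality
open import Relation.Nullary using (¬_; yes; no)

line : {n : ℕ} → Fin n → ℕ
line k = suc (toℕ k)

n≢1+n : ∀ {n} → n ≢ suc n
n≢1+n eq = 1+n≢n (sym eq)

data SimpleTranspositionCase (a x : ℕ) : Set where
  case-a     : x ≡ a → sTrans a x ≡ suc a → SimpleTranspositionCase a x
  case-1+a   : x ≡ suc a → sTrans a x ≡ a → SimpleTranspositionCase a x
  case-other : x ≢ a → x ≢ suc a → sTrans a x ≡ x → SimpleTranspositionCase a x

sTrans-case : ∀ a x → SimpleTranspositionCase a x
sTrans-case a x with x ≡ᵇ a in x≡ᵇa | x ≡ᵇ suc a in x≡ᵇ1+a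
... | true | _ = case-a (≡ᵇ⇒≡ x a (Equivalence.from T-≡ x≡ᵇa)) unfold-a
  where
  unfold-a : sTrans a x ≡ suc a
  unfold-a = cong (λ b → if b then suc a else (if x ≡ᵇ suc a then a else x)) x≡ᵇa
... | false | true = case-1+a (≡ᵇ⇒≡ x (suc a) (Equivalence.from T-≡ x≡ᵇ1+a)) unfold-1+a
  where
  unfold-1+a : sTrans a x ≡ a
  unfold-1+a = cong₂ (λ b b′ → if b then suc a else (if b′ then a else x)) x≡ᵇa x≡ᵇ1+a
... | false | false = case-other (λ eq → subst T x≡ᵇa (≡⇒≡ᵇ x a eq))
                                (λ eq → subst T x≡ᵇ1+a (≡⇒≡ᵇ x (suc a) eq)) unfold-other
  where
  unfold-other : sTrans a x ≡ x
  unfold-other = cong₂ (λ b b′ → if b then suc a else (if b′ then a else x)) x≡ᵇa x≡ᵇ1+a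

sTrans-lower : ∀ a → sTrans a a ≡ suc a
sTrans-lower a with sTrans-case a a
... | case-a _ eq = eq
... | case-1+a a≡1+a _ = ⊥-elim (n≢1+n a≡1+a)
... | case-other a≢a _ _ = ⊥-elim (a≢a refl)

sTrans-upper : ∀ a → sTrans a (suc a) ≡ a
sTrans-upper a with sTrans-case a (suc a)
... | case-a 1+a≡a _ = ⊥-elim (1+n≢n 1+a≡a)
... | case-1+a _ eq = eq
... | case-other _ 1+a≢1+a _ = ⊥-elim (1+a≢1+a refl)

sTrans-fixed : ∀ a {x} → x ≢ a → x ≢ suc a → sTrans a x ≡ x
sTrans-fixed a {x} x≢a x≢1+a with sTrans-case a x
... | case-a x≡a _ = ⊥-elim (x≢a x≡a)
... | case-1+a x≡1+a _ = ⊥-elim (x≢1+a x≡1+a)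
... | case-other _ _ eq = eq

sTrans-fixed-below : ∀ a {x} → x < a → sTrans a x ≡ x
sTrans-fixed-below a x<a = sTrans-fixed a (<⇒≢ x<a) (<⇒≢ (m<n⇒m<1+n x<a))

sTrans-fixed-above : ∀ a {x} → suc a < x → sTrans a x ≡ x
sTrans-fixed-above a 1+a<x =
  sTrans-fixed a (λ x≡a → <⇒≢ (<-trans (n<1+n a) 1+a<x) (sym x≡a))
                 (λ x≡1+a → <⇒≢ 1+a<x (sym x≡1+a))

sTrans-involutive : ∀ a x → sTrans a (sTrans a x) ≡ x
sTrans-involutive a x with sTrans-case a x
... | case-a refl eq = trans (cong (sTrans a) eq) (sTrans-upper a)
... | case-1+a refl eq = trans (cong (sTrans a) eq) (sTrans-lower a)
... | case-other _ _ eq = trans (cong (sTrans a) eq) eq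

sTrans-injective : ∀ a {x y} → sTrans a x ≡ sTrans a y → x ≡ y
sTrans-injective a {x} {y} eq =
  trans (sym (sTrans-involutive a x)) (trans (cong (sTrans a) eq) (sTrans-involutive a y))

sTrans-inverts⇒adjacent : ∀ c {u v} → u < v → sTrans c v < sTrans c u → u ≡ c × v ≡ suc c
sTrans-inverts⇒adjacent c {u} {v} u<v inv with sTrans-case c u | sTrans-case c v
... | case-a refl _  | case-1+a refl _  = refl , refl
... | case-a refl _  | case-a refl _  = ⊥-elim (<-irrefl refl u<v)
... | case-1+a refl _  | case-1+a refl _  = ⊥-elim (<-irrefl refl u<v)
... | case-1+a refl _  | case-a refl _  = ⊥-elim (<-asym u<v (n<1+n c))
... | case-a refl eu | case-other _ _ ev rewrite eu | ev = ⊥-elim (<⇒≱ u<v (≤-pred inv))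
... | case-1+a refl eu | case-other _ _ ev rewrite eu | ev = ⊥-elim (<-asym inv (<-trans (n<1+n c) u<v))
... | case-other _ _ eu  | case-a refl ev rewrite eu | ev = ⊥-elim (<-asym u<v (<-trans (n<1+n c) inv))
... | case-other _ _ eu  | case-1+a refl ev rewrite eu | ev = ⊥-elim (<⇒≱ inv (≤-pred u<v))
... | case-other _ _ eu  | case-other _ _ ev rewrite eu | ev = ⊥-elim (<-asym u<v inv)

sTrans-intertwine : ∀ {h : ℕ → ℕ} → (∀ {x y} → h x ≡ h y → x ≡ y) →
  ∀ {a b} → h b ≡ a → h (suc b) ≡ suc a → ∀ z → sTrans a (h z) ≡ h (sTrans b z)
sTrans-intertwine {h} h-inj {a} {b} hb≡a h1+b≡1+a z with sTrans-case b z
... | case-a refl ez = begin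
  sTrans a (h b)  ≡⟨ cong (sTrans a) hb≡a ⟩
  sTrans a a      ≡⟨ sTrans-lower a ⟩
  suc a           ≡⟨ sym h1+b≡1+a ⟩
  h (suc b)       ≡⟨ cong h (sym ez) ⟩
  h (sTrans b b)  ∎
  where open ≡-Reasoning
... | case-1+a refl ez = begin
  sTrans a (h (suc b))  ≡⟨ cong (sTrans a) h1+b≡1+a ⟩
  sTrans a (suc a)      ≡⟨ sTrans-upper a ⟩
  a                     ≡⟨ sym hb≡a ⟩
  h b                   ≡⟨ cong h (sym ez) ⟩
  h (sTrans b (suc b))  ∎
  where open ≡-Reasoning
... | case-other z≢b z≢1+b ez =
  trans (sTrans-fixed a (λ hz≡a → z≢b (h-inj (trans hz≡a (sym hb≡a))))
                        (λ hz≡1+a → z≢1+b (h-inj (trans hz≡1+a (sym h1+b≡1+a)))))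
        (cong h (sym ez))

prodWord-++ : ∀ X Y z → prodWord (X ++ Y) z ≡ prodWord X (prodWord Y z)
prodWord-++ []      Y z = refl
prodWord-++ (a ∷ X) Y z = cong (sTrans a) (prodWord-++ X Y z)

prodWord-injective : ∀ L {x y} → prodWord L x ≡ prodWord L y → x ≡ y
prodWord-injective []      eq = eq
prodWord-injective (a ∷ L) eq = prodWord-injective L (sTrans-injective a eq)

record SwappingLetter (L : List ℕ) (x y : ℕ) : Set where
  constructor swapsAt
  field
    left   : List ℕ
    letter : ℕ
    right  : List ℕ
    split  : L ≡ left ++ letter ∷ right
    lower  : prodWord right x ≡ letter
    upper  : prodWord right y ≡ suc letter

module _ {L x y} (s : SwappingLetter L x y) where
  open SwappingLetter s

  swappingLetter-lower : prodWord L x ≡ prodWord left (suc letter)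
  swappingLetter-lower = begin
    prodWord L x                                     ≡⟨ cong (λ L′ → prodWord L′ x) split ⟩
    prodWord (left ++ letter ∷ right) x              ≡⟨ prodWord-++ left _ x ⟩
    prodWord left (sTrans letter (prodWord right x)) ≡⟨ cong (prodWord left ∘ sTrans letter) lower ⟩
    prodWord left (sTrans letter letter)             ≡⟨ cong (prodWord left) (sTrans-lower letter) ⟩
    prodWord left (suc letter)                       ∎
    where open ≡-Reasoning

  swappingLetter-upper : prodWord L y ≡ prodWord left letter
  swappingLetter-upper = begin
    prodWord L y                                     ≡⟨ cong (λ L′ → prodWord L′ y) split ⟩
    prodWord (left ++ letter ∷ right) y              ≡⟨ prodWord-++ left _ y ⟩
    prodWord left (sTrans letter (prodWord right y)) ≡⟨ cong (prodWord left ∘ sTrans letter) upper ⟩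
    prodWord left (sTrans letter (suc letter))       ≡⟨ cong (prodWord left) (sTrans-upper letter) ⟩
    prodWord left letter                             ∎
    where open ≡-Reasoning

  swappingLetter-distinct : x ≢ y
  swappingLetter-distinct refl = n≢1+n (trans (sym lower) upper)

inverted⇒swappingLetter : ∀ L {x y} → x < y → prodWord L y < prodWord L x → SwappingLetter L x y
inverted⇒swappingLetter []      x<y inv = ⊥-elim (<-asym x<y inv)
inverted⇒swappingLetter (c ∷ L) {x} {y} x<y inv with prodWord L y <? prodWord L x
... | yes inv′ =
  let swapsAt A b B split lo up = inverted⇒swappingLetter L x<y inv′
  in  swapsAt (c ∷ A) b B (cong (c ∷_) split) lo up
... | no ¬inv′ =
  let ordered = ≤∧≢⇒< (≮⇒≥ ¬inv′) (λ eq → <⇒≢ x<y (prodWord-injective L eq))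
      lo , up = sTrans-inverts⇒adjacent c ordered inv
  in  swapsAt [] c L refl lo up

prodWord-deletePair : ∀ X a Y b Z → (∀ z → sTrans a (prodWord Y z) ≡ prodWord Y (sTrans b z)) →
  ∀ z → prodWord (X ++ a ∷ Y ++ b ∷ Z) z ≡ prodWord (X ++ Y ++ Z) z
prodWord-deletePair X a Y b Z intertwines z = begin
  prodWord (X ++ a ∷ Y ++ b ∷ Z) z
    ≡⟨ prodWord-++ X _ z ⟩
  prodWord X (sTrans a (prodWord (Y ++ b ∷ Z) z))
    ≡⟨ cong (prodWord X ∘ sTrans a) (prodWord-++ Y _ z) ⟩
  prodWord X (sTrans a (prodWord Y (sTrans b (prodWord Z z))))
    ≡⟨ cong (prodWord X) (intertwines _) ⟩
  prodWord X (prodWord Y (sTrans b (sTrans b (prodWord Z z))))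
    ≡⟨ cong (prodWord X ∘ prodWord Y) (sTrans-involutive b _) ⟩
  prodWord X (prodWord Y (prodWord Z z))
    ≡⟨ cong (prodWord X) (sym (prodWord-++ Y Z z)) ⟩
  prodWord X (prodWord (Y ++ Z) z)
    ≡⟨ sym (prodWord-++ X _ z) ⟩
  prodWord (X ++ Y ++ Z) z
    ∎
  where open ≡-Reasoning

length-deletePair : ∀ (X : List ℕ) a Y b Z → length (X ++ Y ++ Z) < length (X ++ a ∷ Y ++ b ∷ Z)
length-deletePair X a Y b Z = subst₂ _<_ (sym deleted) (sym original) shorter
  where
  deleted : length (X ++ Y ++ Z) ≡ length X + (length Y + length Z)
  deleted = trans (length-++ X) (cong (length X +_) (length-++ Y))
  original : length (X ++ a ∷ Y ++ b ∷ Z) ≡ length X + suc (length Y + suc (length Z))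
  original = trans (length-++ X) (cong (λ l → length X + suc l) (length-++ Y))
  shorter : length X + (length Y + length Z) < length X + suc (length Y + suc (length Z))
  shorter = +-monoʳ-< (length X) (s≤s (+-monoʳ-≤ (length Y) (n≤1+n _)))

All-deletePair : ∀ {P : ℕ → Set} X a Y b Z → All P (X ++ a ∷ Y ++ b ∷ Z) → All P (X ++ Y ++ Z)
All-deletePair X a Y b Z all with ++⁻ʳ X all
... | _ ∷ rest with ++⁻ʳ Y rest
...   | _ ∷ restZ = ++⁺ (++⁻ˡ X all) (++⁺ (++⁻ˡ Y rest) restZ)

sTrans-inRange : ∀ {n a z} → Letter n a → 1 ≤ z → z ≤ n → 1 ≤ sTrans a z × sTrans a z ≤ n
sTrans-inRange {n} {a} {z} (1≤a , a<n) 1≤z z≤n′ with sTrans-case a z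
... | case-a _ eq = subst (λ t → 1 ≤ t × t ≤ n) (sym eq) (s≤s z≤n , a<n)
... | case-1+a z≡1+a eq =
  subst (λ t → 1 ≤ t × t ≤ n) (sym eq)
        (1≤a , ≤-trans (n≤1+n a) (subst (_≤ n) z≡1+a z≤n′))
... | case-other _ _ eq = subst (λ t → 1 ≤ t × t ≤ n) (sym eq) (1≤z , z≤n′)

prodWord-onto : ∀ {n} B → All (Letter n) B →
  ∀ {z} → 1 ≤ z → z ≤ n → ∃[ x ] prodWord B (line {n} x) ≡ z
prodWord-onto []      _              {suc z} _ z<n = fromℕ< z<n , cong suc (toℕ-fromℕ< z<n)
prodWord-onto (a ∷ B) (la ∷ letters) {z} 1≤z z≤n′ =
  let 1≤z′ , z′≤n = sTrans-inRange la 1≤z z≤n′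
      x , eq = prodWord-onto B letters 1≤z′ z′≤n
  in  x , trans (cong (sTrans a) eq) (sTrans-involutive a z)

Inversion : {n : ℕ} → Permutation′ n → Fin n → Fin n → Set
Inversion w x y = x F.< y × w ⟨$⟩ʳ y F.< w ⟨$⟩ʳ x

module ReducedWord {n : ℕ} {w : Permutation′ n} {W : List ℕ} (reduced : IsReducedWord n w W) where

  private
    isWord : IsWordFor n w W
    isWord = proj₁ reduced

  letters : All (Letter n) W
  letters = proj₁ isWord

  -- If s_a Y s_b = Y, deleting the letters a and b gives a shorter word for w.
  noRepeatedSwap : ∀ X a Y b Z → W ≡ X ++ a ∷ Y ++ b ∷ Z →
    prodWord Y b ≡ a → prodWord Y (suc b) ≡ suc a → ⊥
  noRepeatedSwap X a Y b Z refl Yb≡a Y1+b≡1+a =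
    <⇒≱ (length-deletePair X a Y b Z) (proj₂ reduced _ shorterWord)
    where
    intertwines : ∀ z → sTrans a (prodWord Y z) ≡ prodWord Y (sTrans b z)
    intertwines = sTrans-intertwine (prodWord-injective Y) Yb≡a Y1+b≡1+a
    shorterWord : IsWordFor n w (X ++ Y ++ Z)
    shorterWord = All-deletePair X a Y b Z letters ,
                  λ x → trans (sym (prodWord-deletePair X a Y b Z intertwines _)) (proj₂ isWord x)

  swappingLetter⇒ordered : ∀ {x y} → SwappingLetter W x y → x < y
  swappingLetter⇒ordered {x} {y} s@(swapsAt A b B split lo up) with <-cmp x y
  ... | tri< x<y _ _ = x<y
  ... | tri≈ _ x≡y _ = ⊥-elim (swappingLetter-distinct s x≡y)
  ... | tri> _ _ y<x =
    let Bx<By = subst₂ _<_ (sym lo) (sym up) (n<1+n b)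
        t = inverted⇒swappingLetter B y<x Bx<By
        open SwappingLetter t using () renaming (left to B₁; letter to c; right to B₂; split to splitB)
        B₁c≡b     = trans (sym (swappingLetter-upper t)) lo
        B₁1+c≡1+b = trans (sym (swappingLetter-lower t)) up
    in  ⊥-elim (noRepeatedSwap A b B₁ c B₂ (trans split (cong (λ L → A ++ b ∷ L) splitB))
                               B₁c≡b B₁1+c≡1+b)

  swappingLetter⇒inverted : ∀ {x y} → SwappingLetter W x y → prodWord W y < prodWord W x
  swappingLetter⇒inverted {x} {y} s@(swapsAt A b B split _ _)
    with <-cmp (prodWord W y) (prodWord W x)
  ... | tri< Wy<Wx _ _ = Wy<Wx
  ... | tri≈ _ Wy≡Wx _ = ⊥-elim (swappingLetter-distinct s (sym (prodWord-injective W Wy≡Wx)))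
  ... | tri> _ _ Wx<Wy =
    let A1+b<Ab = subst₂ _<_ (swappingLetter-lower s) (swappingLetter-upper s) Wx<Wy
        t = inverted⇒swappingLetter A (n<1+n b) A1+b<Ab
        open SwappingLetter t using ()
          renaming (left to A₁; letter to c; right to A₂; split to splitA;
                    lower to A₂b≡c; upper to A₂1+b≡1+c)
        splitW = trans split (trans (cong (_++ b ∷ B) splitA) (++-assoc A₁ (c ∷ A₂) (b ∷ B)))
    in  ⊥-elim (noRepeatedSwap A₁ c A₂ b B splitW A₂b≡c A₂1+b≡1+c)

  swappingLetter⇒inversion : ∀ {x y} → SwappingLetter W (line x) (line y) → Inversion w x y
  swappingLetter⇒inversion s =
    ≤-pred (swappingLetter⇒ordered s) ,
    ≤-pred (subst₂ _<_ (proj₂ isWord _) (proj₂ isWord _) (swappingLetter⇒inverted s))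

  inversion⇒swappingLetter : ∀ {x y} → Inversion w x y → SwappingLetter W (line x) (line y)
  inversion⇒swappingLetter (x<y , wy<wx) =
    inverted⇒swappingLetter W (s≤s x<y)
      (subst₂ _<_ (sym (proj₂ isWord _)) (sym (proj₂ isWord _)) (s≤s wy<wx))

_IsSuffixOf_ : List ℕ → List ℕ → Set
S IsSuffixOf W = ∃[ A ] W ≡ A ++ S

IsSuffixOf-++ : ∀ X S → S IsSuffixOf (X ++ S)
IsSuffixOf-++ X S = X , refl

IsSuffixOf-++ʳ : ∀ U {S T} → S IsSuffixOf T → (S ++ U) IsSuffixOf (T ++ U)
IsSuffixOf-++ʳ U {S} (A , refl) = A , ++-assoc A S U

IsSuffixOf-trans : ∀ {S T W} → S IsSuffixOf T → T IsSuffixOf W → S IsSuffixOf W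
IsSuffixOf-trans {S} (A , refl) (B , refl) = B ++ A , sym (++-assoc B A S)

∷-≡-++∷ : ∀ {x : ℕ} {L W₁ c W₂} → x ∷ L ≡ W₁ ++ c ∷ W₂ →
  (x ≡ c × L ≡ W₂) ⊎ ∃[ W₁′ ] L ≡ W₁′ ++ c ∷ W₂
∷-≡-++∷ {W₁ = []}       refl = inj₁ (refl , refl)
∷-≡-++∷ {W₁ = _ ∷ W₁′} refl = inj₂ (W₁′ , refl)

[]≢++∷ : ∀ {W₁ : List ℕ} {c W₂} → [] ≢ W₁ ++ c ∷ W₂
[]≢++∷ {[]}    ()
[]≢++∷ {_ ∷ _} ()

module ReadingWord (n : ℕ) (R : PosSet) (staircase : InStaircase n R) where

  cellWord : ℕ → ℕ → List ℕ
  cellWord i j = if R i j then (i + j ∸ 1) ∷ [] else []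

  rowWord : ℕ → ℕ → List ℕ
  rowWord i m = concatMap (cellWord i) (colsDown m)

  rowsWord : ℕ → ℕ → List ℕ
  rowsWord zero    s = []
  rowsWord (suc c) s = rowWord s n ++ rowsWord c (suc s)

  rowsBelow : ℕ → List ℕ
  rowsBelow i = rowsWord (n ∸ i) (suc i)

  -- The part of the reading word after the letter of cell (i, m + 1):
  -- cells (i, m), …, (i, 1), then rows i + 1, …, n.
  suffix : ℕ → ℕ → List ℕ
  suffix i m = rowWord i m ++ rowsBelow i

  readingWord≡rowsBelow0 : readingWord n R ≡ rowsBelow 0
  readingWord≡rowsBelow0 = rowsWord-applyUpTo n id 0 (λ _ → refl)
    where
    rowsWord-applyUpTo : ∀ c (f : ℕ → ℕ) s → (∀ t → f t ≡ s + t) →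
      concatMap (λ i → rowWord i n) (map suc (applyUpTo f c)) ≡ rowsWord c (suc s)
    rowsWord-applyUpTo zero    f s f≗s+ = refl
    rowsWord-applyUpTo (suc c) f s f≗s+ =
      cong₂ _++_ (cong (λ t → rowWord (suc t) n) (trans (f≗s+ 0) (+-identityʳ s)))
                 (rowsWord-applyUpTo c (f ∘ suc) (suc s) (λ t → trans (f≗s+ (suc t)) (+-suc s t)))

  outside : ∀ {i j} → n < i + j → R i j ≡ false
  outside {i} {j} n<i+j with R i j in Rij
  ... | true  = ⊥-elim (<⇒≱ n<i+j (proj₂ (proj₂ (staircase i j Rij))))
  ... | false = refl

  rowWord-cross : ∀ {i m} → R i (suc m) ≡ true → rowWord i (suc m) ≡ i + m ∷ rowWord i m
  rowWord-cross {i} {m} Rim rewrite Rim = cong (λ a → a ∷ rowWord i m) (cong (_∸ 1) (+-suc i m))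

  rowWord-elbow : ∀ {i m} → R i (suc m) ≡ false → rowWord i (suc m) ≡ rowWord i m
  rowWord-elbow Rim rewrite Rim = refl

  rowWord-beyond : ∀ i {m} → n ≤ m → rowWord i m ≡ rowWord i n
  rowWord-beyond i {m} n≤m with m≤n⇒m<n∨m≡n n≤m
  ... | inj₂ refl = refl
  rowWord-beyond i {suc m} _ | inj₁ (s≤s n≤m) =
    trans (rowWord-elbow (outside (<-≤-trans (s≤s n≤m) (m≤n+m (suc m) i)))) (rowWord-beyond i n≤m)

  rowWord-belowStaircase : ∀ m → rowWord (suc n) m ≡ []
  rowWord-belowStaircase zero    = refl
  rowWord-belowStaircase (suc m) =
    trans (rowWord-elbow (outside (s≤s (m≤m+n n (suc m))))) (rowWord-belowStaircase m)

  rowsBelow-beyond : ∀ {i} → n ≤ i → rowsBelow i ≡ []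
  rowsBelow-beyond {i} n≤i = cong (λ c → rowsWord c (suc i)) (m≤n⇒m∸n≡0 n≤i)

  rowsBelow-unfold : ∀ {i} → i ≤ n → rowsBelow i ≡ rowWord (suc i) n ++ rowsBelow (suc i)
  rowsBelow-unfold {i} i≤n with m≤n⇒m<n∨m≡n i≤n
  ... | inj₁ i<n  = cong (λ c → rowsWord c (suc i)) (+-∸-assoc 1 i<n)
  ... | inj₂ refl = begin
    rowsBelow n
      ≡⟨ rowsBelow-beyond ≤-refl ⟩
    []
      ≡⟨ sym (rowsBelow-beyond (n≤1+n n)) ⟩
    rowsBelow (suc n)
      ≡⟨ cong (_++ rowsBelow (suc n)) (sym (rowWord-belowStaircase n)) ⟩
    rowWord (suc n) n ++ rowsBelow (suc n)
      ∎
    where open ≡-Reasoning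

  suffix-cross : ∀ {i m} → R i (suc m) ≡ true → suffix i (suc m) ≡ i + m ∷ suffix i m
  suffix-cross {i} Rim = cong (_++ rowsBelow i) (rowWord-cross Rim)

  suffix-elbow : ∀ {i m} → R i (suc m) ≡ false → suffix i (suc m) ≡ suffix i m
  suffix-elbow {i} Rim = cong (_++ rowsBelow i) (rowWord-elbow Rim)

  suffix-rowEnd : ∀ {i m} → i ≤ n → n ≤ m → suffix (suc i) m ≡ suffix i 0
  suffix-rowEnd i≤n n≤m = trans (cong (_++ _) (rowWord-beyond _ n≤m)) (sym (rowsBelow-unfold i≤n))

  suffix-bottom : suffix (suc n) 0 ≡ []
  suffix-bottom = rowsBelow-beyond (n≤1+n n)

  rowsBelow-isSuffix : ∀ i → i ≤ n → rowsBelow i IsSuffixOf readingWord n R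
  rowsBelow-isSuffix zero    _     = [] , readingWord≡rowsBelow0
  rowsBelow-isSuffix (suc i) 1+i≤n =
    IsSuffixOf-trans (IsSuffixOf-++ (rowWord (suc i) n) _)
      (subst (_IsSuffixOf _) (rowsBelow-unfold i≤n) (rowsBelow-isSuffix i i≤n))
    where
    i≤n = ≤-trans (n≤1+n i) 1+i≤n

  rowWord-isSuffix : ∀ i {m m′} → m ≤ m′ → rowWord i m IsSuffixOf rowWord i m′
  rowWord-isSuffix i {m} {m′} m≤m′ with m≤n⇒m<n∨m≡n m≤m′
  ... | inj₂ refl = [] , refl
  rowWord-isSuffix i {m} {suc m′} _ | inj₁ (s≤s m≤m′) =
    IsSuffixOf-trans (rowWord-isSuffix i m≤m′) (IsSuffixOf-++ (cellWord i (suc m′)) _)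

  cross-antidiagonal : ∀ {i m} → R (suc i) (suc m) ≡ true → suc (suc i + m) ≤ n
  cross-antidiagonal {i} {m} Rim = subst (_≤ n) (+-suc (suc i) m) (proj₂ (proj₂ (staircase _ _ Rim)))

  cross-row≤ : ∀ {i m} → R (suc i) (suc m) ≡ true → i ≤ n
  cross-row≤ {i} {m} Rim =
    ≤-trans (≤-trans (m≤m+n i m) (n≤1+n _)) (≤-trans (n≤1+n _) (cross-antidiagonal Rim))

  cross-column≤ : ∀ {i m} → R (suc i) (suc m) ≡ true → suc m ≤ n
  cross-column≤ {i} {m} Rim =
    ≤-trans (s≤s (m≤n+m m i)) (≤-trans (n≤1+n _) (cross-antidiagonal Rim))

  cross-split : ∀ {i m} → R (suc i) (suc m) ≡ true →
    ∃[ A ] readingWord n R ≡ A ++ suc i + m ∷ suffix (suc i) m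
  cross-split {i} {m} Rim =
    let A , eq = IsSuffixOf-trans
                   (IsSuffixOf-++ʳ (rowsBelow (suc i)) (rowWord-isSuffix (suc i) (cross-column≤ Rim)))
                   (subst (_IsSuffixOf _) (rowsBelow-unfold i≤n) (rowsBelow-isSuffix i i≤n))
    in  A , trans eq (cong (A ++_) (suffix-cross Rim))
    where
    i≤n = cross-row≤ Rim

  rowWord-split : ∀ i m T {W₁ c W₂} → rowWord i m ++ T ≡ W₁ ++ c ∷ W₂ →
    (∃[ m′ ] R i (suc m′) ≡ true × c ≡ i + m′ × W₂ ≡ rowWord i m′ ++ T) ⊎
    (∃[ W₁′ ] T ≡ W₁′ ++ c ∷ W₂)
  rowWord-split i zero    T eq = inj₂ (_ , eq)
  rowWord-split i (suc m) T eq with R i (suc m) in Rim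
  ... | false = rowWord-split i m T eq
  ... | true with ∷-≡-++∷ eq
  ...   | inj₁ (refl , rest) = inj₁ (m , Rim , cong (_∸ 1) (+-suc i m) , sym rest)
  ...   | inj₂ (_ , rest)    = rowWord-split i m T rest

  split⇒cross : ∀ {W₁ c W₂} → readingWord n R ≡ W₁ ++ c ∷ W₂ →
    ∃[ i ] ∃[ m ] R (suc i) (suc m) ≡ true × c ≡ suc i + m × W₂ ≡ suffix (suc i) m
  split⇒cross eq = rowsBelow-split n (+-identityʳ n) (trans (sym readingWord≡rowsBelow0) eq)
    where
    rowsBelow-split : ∀ d {i W₁ c W₂} → d + i ≡ n → rowsBelow i ≡ W₁ ++ c ∷ W₂ →
      ∃[ i ] ∃[ m ] R (suc i) (suc m) ≡ true × c ≡ suc i + m × W₂ ≡ suffix (suc i) m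
    rowsBelow-split zero    {i} refl eq = ⊥-elim ([]≢++∷ (trans (sym (rowsBelow-beyond ≤-refl)) eq))
    rowsBelow-split (suc d) {i} d+i≡n eq
      with rowWord-split (suc i) n (rowsBelow (suc i)) (trans (sym (rowsBelow-unfold i≤n)) eq)
      where
      i≤n : i ≤ n
      i≤n = subst (i ≤_) d+i≡n (m≤n+m i (suc d))
    ... | inj₁ (m , Rim , c≡ , rest) = i , m , Rim , c≡ , rest
    ... | inj₂ (_ , eq′) = rowsBelow-split d (trans (+-suc d i) d+i≡n) eq′

toRight≢toTop : toRight ≢ toTop
toRight≢toTop ()

cross-fromLeft : ∀ {b} → b ≡ true → exitDir b fromLeft ≡ toRight
cross-fromLeft refl = refl

cross-fromBottom : ∀ {b} → b ≡ true → exitDir b fromBottom ≡ toTop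
cross-fromBottom refl = refl

elbow-fromLeft : ∀ {b} → b ≡ false → exitDir b fromLeft ≡ toTop
elbow-fromLeft refl = refl

elbow-fromBottom : ∀ {b} → b ≡ false → exitDir b fromBottom ≡ toRight
elbow-fromBottom refl = refl

module LineDiagram (n : ℕ) (R : PosSet) (staircase : InStaircase n R) where
  open ReadingWord n R staircase

  ExitsTop : Fin n → ℕ → ℕ → Set
  ExitsTop k i j = ∃[ d ] Enters R k i j d × exitDir (R i j) d ≡ toTop

  enterFromBelow : ∀ {k i j} → ExitsTop k (suc (suc i)) j → Enters R k (suc i) j fromBottom
  enterFromBelow (_ , en , ex) = goUp en ex

  enteredFromBelow : ∀ {k i j} → Enters R k (suc i) j fromBottom → ExitsTop k (suc (suc i)) j
  enteredFromBelow (goUp en ex) = _ , en , ex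

  enters-row≤ : ∀ {k : Fin n} {i j d} → Enters R k i j d → i ≤ line k
  enters-row≤ start          = ≤-refl
  enters-row≤ (goRight en _) = enters-row≤ en
  enters-row≤ (goUp en _)    = ≤-trans (n≤1+n _) (enters-row≤ en)

  enters-column≥1 : ∀ {k : Fin n} {i j d} → Enters R k i j d → 1 ≤ j
  enters-column≥1 start         = s≤s z≤n
  enters-column≥1 (goRight _ _) = s≤s z≤n
  enters-column≥1 (goUp en _)   = enters-column≥1 en

  enters-firstColumn : ∀ {k : Fin n} {p} → Enters R k p 1 fromLeft → p ≡ line k
  enters-firstColumn start = refl
  enters-firstColumn (goRight en _) with enters-column≥1 en
  ... | ()

  -- The frontier (i, m) runs down the left border of rows 1, …, i - 1, along the tops of the
  -- cells (i, 1), …, (i, m), down the left side of (i, m + 1) and along the tops of the cells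
  -- (i + 1, m + 1), (i + 1, m + 2), …  Its crossing points are numbered by antidiagonal, so that
  -- the cross at (i, m + 1), whose letter is i + m, exchanges the points i + m and i + m + 1.
  data OnFrontier (i m : ℕ) (k : Fin n) (p : ℕ) : Set where
    leftBorder  : p < i → Enters R k p 1 fromLeft → OnFrontier i m k p
    overRow     : ∀ c → c < m → p ≡ i + c → ExitsTop k i (suc c) → OnFrontier i m k p
    corner      : p ≡ i + m → Enters R k i (suc m) fromLeft → OnFrontier i m k p
    overNextRow : ∀ c → m < c → p ≡ i + c → ExitsTop k (suc i) c → OnFrontier i m k p

  record FrontierInvariant (i m : ℕ) : Set where
    field
      onFrontier : ∀ k → OnFrontier i m k (prodWord (suffix i m) (line k))
      unique     : ∀ {k p} → OnFrontier i m k p → p ≡ prodWord (suffix i m) (line k)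

  module _ {i m : ℕ} {k : Fin n} where
    private
      a = suc i + m
      Before = OnFrontier (suc i) m k
      After  = OnFrontier (suc i) (suc m) k

      a+1≡ : suc a ≡ suc i + suc m
      a+1≡ = sym (+-suc (suc i) m)

      fixed-below : ∀ {c} → c < m → sTrans a (suc i + c) ≡ suc i + c
      fixed-below c<m = sTrans-fixed-below a (+-monoʳ-< (suc i) c<m)

      fixed-above : ∀ {c} → suc m < c → sTrans a (suc i + c) ≡ suc i + c
      fixed-above {c} 1+m<c =
        sTrans-fixed-above a (subst (_< suc i + c) (sym a+1≡) (+-monoʳ-< (suc i) 1+m<c))

    cross-forward : R (suc i) (suc m) ≡ true → ∀ {p} → Before p → After (sTrans a p)
    cross-forward Rim (leftBorder p<i en) =
      subst After (sym (sTrans-fixed-below a (<-≤-trans p<i (m≤m+n _ m)))) (leftBorder p<i en)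
    cross-forward Rim (overRow c c<m refl top) =
      subst After (sym (fixed-below c<m)) (overRow c (m<n⇒m<1+n c<m) refl top)
    cross-forward Rim (corner refl en) =
      subst After (sym (sTrans-lower a)) (corner a+1≡ (goRight en (cross-fromLeft Rim)))
    cross-forward Rim (overNextRow c m<c refl top) with m≤n⇒m<n∨m≡n m<c
    ... | inj₁ 1+m<c = subst After (sym (fixed-above 1+m<c)) (overNextRow c 1+m<c refl top)
    ... | inj₂ refl  =
      subst After (sym (trans (cong (sTrans a) (sym a+1≡)) (sTrans-upper a)))
        (overRow m (n<1+n m) refl (fromBottom , enterFromBelow top , cross-fromBottom Rim))

    cross-backward : R (suc i) (suc m) ≡ true → ∀ {p} → After p → Before (sTrans a p)
    cross-backward Rim (leftBorder p<i en) =
      subst Before (sym (sTrans-fixed-below a (<-≤-trans p<i (m≤m+n _ m)))) (leftBorder p<i en)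
    cross-backward Rim (overRow c c<1+m refl top) with m≤n⇒m<n∨m≡n (≤-pred c<1+m)
    ... | inj₁ c<m = subst Before (sym (fixed-below c<m)) (overRow c c<m refl top)
    cross-backward Rim (overRow c c<1+m refl (fromLeft , _ , ex))    | inj₂ refl =
      ⊥-elim (toRight≢toTop (trans (sym (cross-fromLeft Rim)) ex))
    cross-backward Rim (overRow c c<1+m refl (fromBottom , en , _)) | inj₂ refl =
      subst Before (sym (sTrans-lower a)) (overNextRow (suc m) (n<1+n m) a+1≡ (enteredFromBelow en))
    cross-backward Rim (corner refl (goRight {d = fromLeft} en _)) =
      subst Before (sym (trans (cong (sTrans a) (sym a+1≡)) (sTrans-upper a))) (corner refl en)
    cross-backward Rim (corner refl (goRight {d = fromBottom} _ ex)) =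
      ⊥-elim (toRight≢toTop (trans (sym ex) (cross-fromBottom Rim)))
    cross-backward Rim (overNextRow c 1+m<c refl top) =
      subst Before (sym (fixed-above 1+m<c)) (overNextRow c (<-trans (n<1+n m) 1+m<c) refl top)

    elbow-forward : R (suc i) (suc m) ≡ false → ∀ {p} → Before p → After p
    elbow-forward Rim (leftBorder p<i en)    = leftBorder p<i en
    elbow-forward Rim (overRow c c<m eq top) = overRow c (m<n⇒m<1+n c<m) eq top
    elbow-forward Rim (corner eq en)         = overRow m (n<1+n m) eq (fromLeft , en , elbow-fromLeft Rim)
    elbow-forward Rim (overNextRow c m<c eq top) with m≤n⇒m<n∨m≡n m<c
    ... | inj₁ 1+m<c = overNextRow c 1+m<c eq top
    ... | inj₂ refl  = corner eq (goRight (enterFromBelow top) (elbow-fromBottom Rim))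

    elbow-backward : R (suc i) (suc m) ≡ false → ∀ {p} → After p → Before p
    elbow-backward Rim (leftBorder p<i en) = leftBorder p<i en
    elbow-backward Rim (overRow c c<1+m eq top) with m≤n⇒m<n∨m≡n (≤-pred c<1+m)
    ... | inj₁ c<m = overRow c c<m eq top
    elbow-backward Rim (overRow c c<1+m eq (fromLeft , en , _))    | inj₂ refl = corner eq en
    elbow-backward Rim (overRow c c<1+m eq (fromBottom , _ , ex)) | inj₂ refl =
      ⊥-elim (toRight≢toTop (trans (sym (elbow-fromBottom Rim)) ex))
    elbow-backward Rim (corner eq (goRight {d = fromBottom} en _)) =
      overNextRow (suc m) (n<1+n m) eq (enteredFromBelow en)
    elbow-backward Rim (corner eq (goRight {d = fromLeft} _ ex)) =
      ⊥-elim (toRight≢toTop (trans (sym ex) (elbow-fromLeft Rim)))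
    elbow-backward Rim (overNextRow c 1+m<c eq top) =
      overNextRow c (<-trans (n<1+n m) 1+m<c) eq top

  open FrontierInvariant

  invariant-step : ∀ {i m} → FrontierInvariant (suc i) m → FrontierInvariant (suc i) (suc m)
  invariant-step {i} {m} inv with R (suc i) (suc m) in Rim
  ... | true = record
    { onFrontier = λ k →
        subst (OnFrontier _ _ k) (sym (suffix≡ (line k))) (cross-forward Rim (onFrontier inv k))
    ; unique     = λ {k} {p} fr → begin
        p
          ≡⟨ sym (sTrans-involutive a p) ⟩
        sTrans a (sTrans a p)
          ≡⟨ cong (sTrans a) (unique inv (cross-backward Rim fr)) ⟩
        sTrans a (prodWord (suffix (suc i) m) (line k))
          ≡⟨ sym (suffix≡ (line k)) ⟩
        prodWord (suffix (suc i) (suc m)) (line k)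
          ∎
    }
    where
    open ≡-Reasoning
    a = suc i + m
    suffix≡ : ∀ x → prodWord (suffix (suc i) (suc m)) x ≡ sTrans a (prodWord (suffix (suc i) m) x)
    suffix≡ x = cong (λ L → prodWord L x) (suffix-cross Rim)
  ... | false = record
    { onFrontier = λ k →
        subst (OnFrontier _ _ k) (sym (suffix≡ (line k))) (elbow-forward Rim (onFrontier inv k))
    ; unique     = λ fr → trans (unique inv (elbow-backward Rim fr)) (sym (suffix≡ _))
    }
    where
    suffix≡ : ∀ x → prodWord (suffix (suc i) (suc m)) x ≡ prodWord (suffix (suc i) m) x
    suffix≡ x = cong (λ L → prodWord L x) (suffix-elbow Rim)

  invariant-row : ∀ {i} → FrontierInvariant (suc i) 0 → ∀ m → FrontierInvariant (suc i) m
  invariant-row inv zero    = inv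
  invariant-row inv (suc m) = invariant-step (invariant-row inv m)

  invariant-bottom : FrontierInvariant (suc n) 0
  invariant-bottom = record
    { onFrontier = λ k →
        subst (OnFrontier _ _ k) (sym (suffix≡ (line k))) (leftBorder (s≤s (toℕ<n k)) start)
    ; unique     = λ fr → trans (atStart fr) (sym (suffix≡ _))
    }
    where
    suffix≡ : ∀ x → prodWord (suffix (suc n) 0) x ≡ x
    suffix≡ x = cong (λ L → prodWord L x) suffix-bottom
    atStart : ∀ {k p} → OnFrontier (suc n) 0 k p → p ≡ line k
    atStart (leftBorder _ en)   = enters-firstColumn en
    atStart (overRow _ () _ _)
    atStart {k} (corner _ en)   = ⊥-elim (<⇒≱ (s≤s (toℕ<n k)) (enters-row≤ en))
    atStart {k} (overNextRow _ _ _ (_ , en , _)) =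
      ⊥-elim (<⇒≱ (s≤s (toℕ<n k)) (≤-trans (n≤1+n _) (enters-row≤ en)))

  -- Row i + 1 has no letters beyond column n, so the frontiers (i + 1, M) for M ≥ n and (i, 0)
  -- carry the same labels; M is taken large enough that the slot in question lies left of it.
  invariant-rowChange : ∀ {i} → i ≤ n → (∀ m → FrontierInvariant (suc i) m) →
    FrontierInvariant i 0
  invariant-rowChange {i} i≤n inv = record { onFrontier = onFrontier′ ; unique = unique′ }
    where
    suffix≡ : ∀ {M} → n ≤ M → ∀ x → prodWord (suffix (suc i) M) x ≡ prodWord (suffix i 0) x
    suffix≡ n≤M x = cong (λ L → prodWord L x) (suffix-rowEnd i≤n n≤M)

    descend : ∀ {M k p} → p < suc i + M → OnFrontier (suc i) M k p → OnFrontier i 0 k p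
    descend _ (leftBorder p<1+i en) with m≤n⇒m<n∨m≡n (≤-pred p<1+i)
    ... | inj₁ p<i  = leftBorder p<i en
    ... | inj₂ refl = corner (sym (+-identityʳ i)) en
    descend _ (overRow c _ eq top) = overNextRow (suc c) (s≤s z≤n) (trans eq (sym (+-suc i c))) top
    descend p<end (corner refl _)  = ⊥-elim (<-irrefl refl p<end)
    descend p<end (overNextRow c M<c refl _) = ⊥-elim (<-asym p<end (+-monoʳ-< (suc i) M<c))

    ascend : ∀ {k p} → OnFrontier i 0 k p → ∃[ M ] n ≤ M × OnFrontier (suc i) M k p
    ascend (leftBorder p<i en) = n , ≤-refl , leftBorder (m<n⇒m<1+n p<i) en
    ascend (overRow _ () _ _)
    ascend {k} (corner eq en) =
      n , ≤-refl , leftBorder (subst (_< suc i) (sym p≡i) (n<1+n i))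
                              (subst (λ r → Enters R k r 1 fromLeft) (sym p≡i) en)
      where p≡i = trans eq (+-identityʳ i)
    ascend (overNextRow zero () _ _)
    ascend (overNextRow (suc c) _ eq top) =
      n + suc c , m≤m+n n _ ,
      overRow c (≤-trans (n<1+n c) (m≤n+m (suc c) n)) (trans eq (+-suc i c)) top

    onFrontier′ : ∀ k → OnFrontier i 0 k (prodWord (suffix i 0) (line k))
    onFrontier′ k =
      descend (s≤s (≤-trans (m≤n+m v n) (m≤n+m (n + v) i)))
              (subst (OnFrontier (suc i) (n + v) k) (suffix≡ (m≤m+n n v) (line k))
                     (onFrontier (inv (n + v)) k))
      where v = prodWord (suffix i 0) (line k)

    unique′ : ∀ {k p} → OnFrontier i 0 k p → p ≡ prodWord (suffix i 0) (line k)
    unique′ fr = let M , n≤M , fr′ = ascend fr in trans (unique (inv M) fr′) (suffix≡ n≤M _)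

  frontierInvariant : ∀ {i} m → i ≤ n → FrontierInvariant (suc i) m
  frontierInvariant {i} m i≤n = rows (n ∸ i) (m∸n+n≡m i≤n) m
    where
    rows : ∀ d {i} → d + i ≡ n → ∀ m → FrontierInvariant (suc i) m
    rows zero    refl = invariant-row invariant-bottom
    rows (suc d) {i} d+i≡n =
      invariant-row (invariant-rowChange (subst (suc i ≤_) d+i≡n (s≤s (m≤n+m i d)))
                                         (rows d (trans (+-suc d i) d+i≡n)))

  entersFromLeft⇔ : ∀ {i m k} → i ≤ n →
    Enters R k (suc i) (suc m) fromLeft ⇔ prodWord (suffix (suc i) m) (line k) ≡ suc i + m
  entersFromLeft⇔ {i} {m} {k} i≤n = mk⇔
    (λ en → sym (unique inv (corner refl en)))
    (λ at → atCorner (subst (OnFrontier (suc i) m k) at (onFrontier inv k)))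
    where
    inv = frontierInvariant m i≤n
    atCorner : OnFrontier (suc i) m k (suc i + m) → Enters R k (suc i) (suc m) fromLeft
    atCorner (leftBorder p<1+i _)     = ⊥-elim (<⇒≱ p<1+i (m≤m+n (suc i) m))
    atCorner (overRow c c<m eq _)     = ⊥-elim (<⇒≢ c<m (sym (+-cancelˡ-≡ (suc i) m c eq)))
    atCorner (corner _ en)            = en
    atCorner (overNextRow c m<c eq _) = ⊥-elim (<⇒≢ m<c (+-cancelˡ-≡ (suc i) m c eq))

  entersFromBottom⇔ : ∀ {i m k} → i ≤ n →
    Enters R k (suc i) (suc m) fromBottom ⇔ prodWord (suffix (suc i) m) (line k) ≡ suc (suc i + m)
  entersFromBottom⇔ {i} {m} {k} i≤n = mk⇔
    (λ en → sym (unique inv (overNextRow (suc m) (n<1+n m) a+1≡ (enteredFromBelow en))))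
    (λ at → belowCorner (subst (OnFrontier (suc i) m k) at (onFrontier inv k)))
    where
    inv = frontierInvariant m i≤n
    a+1≡ : suc (suc i + m) ≡ suc i + suc m
    a+1≡ = sym (+-suc (suc i) m)
    belowCorner : OnFrontier (suc i) m k (suc (suc i + m)) → Enters R k (suc i) (suc m) fromBottom
    belowCorner (leftBorder p<1+i _) = ⊥-elim (<⇒≱ p<1+i (≤-trans (m≤m+n (suc i) m) (n≤1+n _)))
    belowCorner (overRow c c<m eq _) =
      ⊥-elim (<⇒≢ (<-trans (+-monoʳ-< (suc i) c<m) (n<1+n _)) (sym eq))
    belowCorner (corner eq _) = ⊥-elim (1+n≢n eq)
    belowCorner (overNextRow c _ eq top) =
      let c≡1+m = +-cancelˡ-≡ (suc i) c (suc m) (trans (sym eq) a+1≡)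
      in  enterFromBelow (subst (ExitsTop k (suc (suc i))) c≡1+m top)

module RCGraph {n : ℕ} {w : Permutation′ n} {R : PosSet} (rc : IsRCGraph n w R) where
  open ReadingWord n R (proj₁ rc)
  open LineDiagram n R (proj₁ rc)
  open ReducedWord {n} {w} {readingWord n R} (proj₂ rc)

  cross-coordinates : ∀ {i j} → R i j ≡ true → ∃[ i′ ] ∃[ m ] i ≡ suc i′ × j ≡ suc m
  cross-coordinates {i} {j} Rij with proj₁ rc i j Rij
  ... | s≤s _ , s≤s _ , _ = _ , _ , refl , refl

  cross⇒inversion : ∀ {i m x y} → R (suc i) (suc m) ≡ true →
    prodWord (suffix (suc i) m) (line x) ≡ suc i + m →
    prodWord (suffix (suc i) m) (line y) ≡ suc (suc i + m) → Inversion w x y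
  cross⇒inversion Rim x-at y-at =
    let A , split = cross-split Rim in swappingLetter⇒inversion (swapsAt A _ _ split x-at y-at)

  suffix-onto : ∀ {i m z} → R (suc i) (suc m) ≡ true → 1 ≤ z → z ≤ n →
    ∃[ x ] prodWord (suffix (suc i) m) (line x) ≡ z
  suffix-onto Rim with cross-split Rim
  ... | A , split with ++⁻ʳ A (subst (All (Letter n)) split letters)
  ...   | _ ∷ suffixLetters = prodWord-onto _ suffixLetters

  vertical⇒inversion : ∀ {k i j} → TraversesVertically R k i j → ∃[ x ] Inversion w x k
  vertical⇒inversion (Rij , en) with cross-coordinates Rij
  ... | _ , _ , refl , refl =
    let x , x-at = suffix-onto Rij (s≤s z≤n) (≤-trans (n≤1+n _) (cross-antidiagonal Rij))
    in  x , cross⇒inversion Rij x-at (Equivalence.to (entersFromBottom⇔ (cross-row≤ Rij)) en)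

  horizontal⇒inversion : ∀ {k i j} → TraversesHorizontally R k i j → ∃[ y ] Inversion w k y
  horizontal⇒inversion (Rij , en) with cross-coordinates Rij
  ... | _ , _ , refl , refl =
    let y , y-at = suffix-onto Rij (s≤s z≤n) (cross-antidiagonal Rij)
    in  y , cross⇒inversion Rij (Equivalence.to (entersFromLeft⇔ (cross-row≤ Rij)) en) y-at

  inversion⇒crossing : ∀ {x y} → Inversion w x y →
    ∃[ i ] ∃[ j ] TraversesHorizontally R x i j × TraversesVertically R y i j
  inversion⇒crossing inv with inversion⇒swappingLetter inv
  ... | swapsAt _ _ _ split x-at y-at with split⇒cross split
  ...   | i , m , Rim , refl , refl =
    suc i , suc m , (Rim , Equivalence.from (entersFromLeft⇔ (cross-row≤ Rim)) x-at)
                  , (Rim , Equivalence.from (entersFromBottom⇔ (cross-row≤ Rim)) y-at)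

  vertical-horizontal-distinct : ∀ {k i j i′ j′} →
    TraversesVertically R k i j → TraversesHorizontally R k i′ j′ → (i , j) ≢ (i′ , j′)
  vertical-horizontal-distinct (Rij , below) (_ , left) refl with cross-coordinates Rij
  ... | _ , _ , refl , refl =
    n≢1+n (trans (sym (Equivalence.to (entersFromLeft⇔ (cross-row≤ Rij)) left))
                 (Equivalence.to (entersFromBottom⇔ (cross-row≤ Rij)) below))

lemma6p7 : (n : ℕ) (w : Permutation′ n) →
    (Avoids321 w → ∀ (R : PosSet) → IsRCGraph n w R → ¬ HasMixedLine n R)
    × (Contains321 w → ∀ (R : PosSet) → IsRCGraph n w R → HasMixedLine n R)
lemma6p7 n w = avoids⇒noMixedLine , contains⇒mixedLine
  where
  avoids⇒noMixedLine : Avoids321 w → ∀ R → IsRCGraph n w R → ¬ HasMixedLine n R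
  avoids⇒noMixedLine avoids R rc (k , _ , _ , _ , _ , _ , vertical , horizontal) =
    let x , (x<k , wk<wx) = vertical⇒inversion vertical
        y , (k<y , wy<wk) = horizontal⇒inversion horizontal
    in  avoids (x , k , y , x<k , k<y , wy<wk , wk<wx)
    where open RCGraph {n} {w} {R} rc

  contains⇒mixedLine : Contains321 w → ∀ R → IsRCGraph n w R → HasMixedLine n R
  contains⇒mixedLine (x , k , y , x<k , k<y , wy<wk , wk<wx) R rc =
    let i  , j  , _ , vertical   = inversion⇒crossing (x<k , wk<wx)
        i′ , j′ , horizontal , _ = inversion⇒crossing (k<y , wy<wk)
    in  k , i , j , i′ , j′ , vertical-horizontal-distinct vertical horizontal , vertical , horizontal
    where open RCGraph {n} {w} {R} rc
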